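{- Let $m, n$ be positive integers with $m \leq n$. Then \[ \gamma(Q_{m \times n}) \geq \min \left\{ m, \left\lceil \frac{m+n-2}{4} \right\rceil \right\}. \]
   Context: The $m \times n$ chessboard has squares $(x,y)$ with $1 \le x \le n$ (column $x$) and $1 \le y \le m$ (row $y$). The queens graph $Q_{m \times n}$ has these squares as vertices; two distinct squares are adjacent if they lie in the same row, the same column, the same difference diagonal (same value of $y-x$) or the same sum diagonal (same value of $y+x$). A set $D$ of squares is a dominating set if every square is in $D$ or adjacent to a square of $D$; $\gamma(Q_{m \times n})$ denotes the minimum size of a dominating set. -}

module Defs where

open import Data.Nat using (ℕ; _+_; _≤_; _⊔_)
open import Data.Fin using (Fin; toℕ)
open import Data.Product using (_×_; _,_)
open import Data.Sum using (_⊎_)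
open import Data.List using (List)
open import Data.List.Membership.Propositional using (_∈_)
open import Data.List.Relation.Unary.Any using (Any)
open import Relation.Binary.PropositionalEquality using (_≡_)

-- A square of the m × n board: (x , y) with column x ∈ {0..n-1}, row y ∈ {0..m-1}
-- (0-indexed; this shift of the paper's 1-indexed coordinates preserves all
-- four line relations below).
Square : ℕ → ℕ → Set
Square m n = Fin n × Fin m

col : ∀ {m n} → Square m n → ℕ
col (x , _) = toℕ x

row : ∀ {m n} → Square m n → ℕ
row (_ , y) = toℕ y

-- s and t lie on a common queen line (same row, column, difference diagonal
-- y - x, or sum diagonal y + x).  y - x = y' - x'  is written  y + x' = y' + x.
SameLine : ∀ {m n} → Square m n → Square m n → Set
SameLine s t =
  (row s ≡ row t) ⊎ (col s ≡ col t) ⊎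
  (row s + col t ≡ row t + col s) ⊎ (row s + col s ≡ row t + col t)

Dominated : ∀ {m n} → List (Square m n) → Square m n → Set
Dominated D t = (t ∈ D) ⊎ Any (λ d → SameLine d t) D

Dominating : (m n : ℕ) → List (Square m n) → Set
Dominating m n D = (t : Square m n) → Dominated D t

-- If D has k < m queens, at least n − k columns and m − k rows carry no queen, so every
-- square lying in an empty row and an empty column is attacked along a diagonal.  Let a, b be
-- the outermost empty columns and c, d the outermost empty rows, and walk around the frame of
-- this grid of empty lines.  The squares of the bottom and right sides lie on pairwise distinct
-- sum diagonals, as do those of the left and top sides; those of the bottom and left sides lie
-- on pairwise distinct difference diagonals, as do those of the right and top sides.  Counting
-- every frame square in both pairings gives 2 (#emptyColumns + #emptyRows − 2) ≤ 4k, hence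
-- m + n ≤ 4k + 2.

module Submission where

open import Defs
open import Data.Nat using (ℕ; _+_; _≤_; _⊓_; _/_; suc)
open import Data.List using (List; length)
open import Data.List.Relation.Unary.Unique.Propositional using (Unique)

open import Data.Nat using (_*_; _∸_; _<_; z≤n; s≤s; s≤s⁻¹; _≤?_; _≟_)
open import Data.Nat.Properties
open import Data.Nat.DivMod using (m<n*o⇒m/o<n)
open import Data.Nat.Tactic.RingSolver using (solve-∀)
open import Data.Fin as Fin using (Fin; toℕ)
open import Data.Fin.Properties using (toℕ-injective; toℕ≤n)
import Data.Fin.Properties as FinProperties
open import Data.List using ([]; _∷_; _++_; map; filter; allFin)
open import Data.List.Properties using (length-map; length-++; length-++-sucʳ; filter-++; length-tabulate)
open import Data.List.Membership.Propositional using (_∈_; _∉_; find)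
open import Data.List.Membership.Propositional.Properties
  using (∈-∃++; ∈-++⁻; ∈-++⁺ˡ; ∈-++⁺ʳ; ∈-map⁺; ∈-map⁻; ∈-filter⁻)
open import Data.List.Relation.Binary.Subset.Propositional using (_⊆_)
open import Data.List.Relation.Unary.Any using (here; there)
open import Data.List.Relation.Unary.All as All using (All; []; _∷_)
import Data.List.Relation.Unary.All.Properties as All
open import Data.List.Relation.Unary.AllPairs as AllPairs using (AllPairs; []; _∷_)
import Data.List.Relation.Unary.AllPairs.Properties as AllPairs
import Data.List.Relation.Unary.Unique.Propositional.Properties as Unique
import Data.List.Extrema
import Data.List.Membership.DecPropositional as DecMembership
open import Data.Product using (_×_; _,_; proj₁; proj₂; ∃-syntax)
open import Data.Sum using (_⊎_; inj₁; inj₂; [_,_]′)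
open import Data.Empty using (⊥-elim)
open import Function using (_on_; _∘_; id)
open import Relation.Binary.Bundles using (TotalOrder)
open import Relation.Binary.Definitions using (DecidableEquality)
open import Relation.Binary.PropositionalEquality
  using (_≡_; _≢_; refl; sym; trans; cong; cong₂; subst; module ≡-Reasoning)
open import Relation.Nullary using (¬_; yes; no; ¬?; _×-dec_)
open import Relation.Unary using (Decidable)
open import Relation.Unary.Properties using (∁?)

private
  variable
    A B C : Set

unique-⊆⇒length≤ : {xs ys : List A} → Unique xs → xs ⊆ ys → length xs ≤ length ys
unique-⊆⇒length≤ {xs = []} _ _ = z≤n
unique-⊆⇒length≤ {xs = x ∷ xs} (x∉xs ∷ uxs) xs⊆ys with ∈-∃++ (xs⊆ys (here refl))
... | ys₁ , ys₂ , refl = begin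
    suc (length xs)           ≤⟨ s≤s (unique-⊆⇒length≤ uxs xs⊆ys₁++ys₂) ⟩
    suc (length (ys₁ ++ ys₂)) ≡⟨ sym (length-++-sucʳ ys₁ x ys₂) ⟩
    length (ys₁ ++ x ∷ ys₂)   ∎
  where
  open ≤-Reasoning
  xs⊆ys₁++ys₂ : xs ⊆ ys₁ ++ ys₂
  xs⊆ys₁++ys₂ {z} z∈xs with ∈-++⁻ ys₁ (xs⊆ys (there z∈xs))
  ... | inj₁ z∈ys₁         = ∈-++⁺ˡ z∈ys₁
  ... | inj₂ (here z≡x)    = ⊥-elim (All.lookup x∉xs z∈xs (sym z≡x))
  ... | inj₂ (there z∈ys₂) = ∈-++⁺ʳ ys₁ z∈ys₂

module _ {P : A → Set} (P? : Decidable P) where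

  length-filter≤ : {xs : List A} {ys : List B} (f : A → B) → AllPairs (_≢_ on f) xs →
                   All (λ x → P x → f x ∈ ys) xs → length (filter P? xs) ≤ length ys
  length-filter≤ {xs = xs} {ys = ys} f separated image = begin
      length (filter P? xs)
    ≡⟨ length-map f (filter P? xs) ⟨
      length (map f (filter P? xs))
    ≤⟨ unique-⊆⇒length≤ (AllPairs.map⁺ (AllPairs.filter⁺ P? separated)) image⊆ys ⟩
      length ys
    ∎
    where
    open ≤-Reasoning
    image⊆ys : map f (filter P? xs) ⊆ ys
    image⊆ys v∈ with ∈-map⁻ f v∈
    ... | x , x∈ , refl with ∈-filter⁻ P? x∈
    ...   | x∈xs , Px = All.lookup image x∈xs Px

  length-filter-++ : (xs ys : List A) →
                     length (filter P? (xs ++ ys)) ≡ length (filter P? xs) + length (filter P? ys)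
  length-filter-++ xs ys = trans (cong length (filter-++ P? xs ys)) (length-++ (filter P? xs))

  length-filter+filter-∁ : (xs : List A) →
                           length xs ≡ length (filter P? xs) + length (filter (∁? P?) xs)
  length-filter+filter-∁ [] = refl
  length-filter+filter-∁ (x ∷ xs) with P? x
  ... | yes _ = cong suc (length-filter+filter-∁ xs)
  ... | no _  = trans (cong suc (length-filter+filter-∁ xs)) (sym (+-suc _ _))

four-sides-bound : {A : Set} {P : A → Set} (P? : Decidable P) → ∀ {s t} (B R L T : List A) →
  length (filter P? (B ++ R)) ≤ s → length (filter P? (L ++ T)) ≤ s →
  length (filter (∁? P?) (B ++ L)) ≤ t → length (filter (∁? P?) (R ++ T)) ≤ t →
  length B + length R + (length L + length T) ≤ 2 * (s + t)
four-sides-bound {A} P? {s} {t} B R L T BR LT BL RT = begin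
    length B + length R + (length L + length T)
  ≡⟨ cong₂ _+_ (cong₂ _+_ (split B) (split R)) (cong₂ _+_ (split L) (split T)) ⟩
    (p B + q B) + (p R + q R) + ((p L + q L) + (p T + q T))
  ≡⟨ regroup (p B) (q B) (p R) (q R) (p L) (q L) (p T) (q T) ⟩
    (p B + p R) + (p L + p T) + ((q B + q L) + (q R + q T))
  ≡⟨ cong₂ _+_ (cong₂ _+_ (length-filter-++ P? B R) (length-filter-++ P? L T))
               (cong₂ _+_ (length-filter-++ (∁? P?) B L) (length-filter-++ (∁? P?) R T)) ⟨
    p (B ++ R) + p (L ++ T) + (q (B ++ L) + q (R ++ T))
  ≤⟨ +-mono-≤ (+-mono-≤ BR LT) (+-mono-≤ BL RT) ⟩
    s + s + (t + t)
  ≡⟨ double s t ⟩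
    2 * (s + t)
  ∎
  where
  open ≤-Reasoning
  p q : List A → ℕ
  p xs = length (filter P? xs)
  q xs = length (filter (∁? P?) xs)
  split : ∀ xs → length xs ≡ p xs + q xs
  split = length-filter+filter-∁ P?
  regroup : ∀ a b c d e f g h →
            (a + b) + (c + d) + ((e + f) + (g + h)) ≡ (a + c) + (e + g) + ((b + f) + (d + h))
  regroup = solve-∀
  double : ∀ a b → a + a + (b + b) ≡ 2 * (a + b)
  double = solve-∀

injective⇒separated : {f : A → B} {xs : List A} → (∀ {x y} → f x ≡ f y → x ≡ y) →
                      Unique xs → AllPairs (_≢_ on f) xs
injective⇒separated injective = AllPairs.map (λ x≢y fx≡fy → x≢y (injective fx≡fy))

AllPairs-map-++ : {R : A → A → Set} {xs : List B} {ys : List C} (g : B → A) (h : C → A) →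
                  AllPairs (R on g) xs → AllPairs (R on h) ys →
                  (∀ {x y} → x ∈ xs → y ∈ ys → R (g x) (h y)) → AllPairs R (map g xs ++ map h ys)
AllPairs-map-++ g h Rxs Rys cross = AllPairs.++⁺ (AllPairs.map⁺ Rxs) (AllPairs.map⁺ Rys)
  (All.map⁺ (All.tabulate λ x∈ → All.map⁺ (All.tabulate λ y∈ → cross x∈ y∈)))

module _ {A : Set} (_≟ᴬ_ : DecidableEquality A) where
  open DecMembership _≟ᴬ_ using (_∈?_; _∉?_)

  length≤length+missing : {xs : List A} (ys : List A) → Unique xs →
                          length xs ≤ length ys + length (filter (_∉? ys) xs)
  length≤length+missing {xs} ys uxs = begin
      length xs
    ≡⟨ length-filter+filter-∁ (_∈? ys) xs ⟩
      length (filter (_∈? ys) xs) + length (filter (_∉? ys) xs)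
    ≤⟨ +-monoˡ-≤ _ (length-filter≤ (_∈? ys) id uxs (All.universal (λ _ → id) xs)) ⟩
      length ys + length (filter (_∉? ys) xs)
    ∎
    where open ≤-Reasoning

module _ {a ℓ₁ ℓ₂} (O : TotalOrder a ℓ₁ ℓ₂) where
  open TotalOrder O using (Carrier) renaming (_≤_ to _≼_)
  open Data.List.Extrema O using (min; max; argmin-sel; argmax-sel; min≤⊤; min≤xs; ⊥≤max; xs≤max)

  least : (xs : List Carrier) → 0 < length xs → ∃[ a ] a ∈ xs × All (a ≼_) xs
  least (x ∷ xs) _ = min x xs , [ here , there ]′ (argmin-sel id x xs) , min≤⊤ x xs ∷ min≤xs x xs

  greatest : (xs : List Carrier) → 0 < length xs → ∃[ b ] b ∈ xs × All (_≼ b) xs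
  greatest (x ∷ xs) _ = max x xs , [ here , there ]′ (argmax-sel id x xs) , ⊥≤max x xs ∷ xs≤max x xs

between? : {k : ℕ} (c d : Fin k) → Decidable (λ (y : Fin k) → c Fin.< y × y Fin.< d)
between? c d y = (c Fin.<? y) ×-dec (y Fin.<? d)

length≤between+2 : {k : ℕ} {c d : Fin k} {ys : List (Fin k)} → Unique ys →
                   All (λ y → c Fin.≤ y × y Fin.≤ d) ys →
                   length ys ≤ length (filter (between? c d) ys) + 2
length≤between+2 {c = c} {d} {ys} uys bounded = begin
    length ys
  ≡⟨ length-filter+filter-∁ (between? c d) ys ⟩
    length (filter (between? c d) ys) + length (filter (∁? (between? c d)) ys)
  ≤⟨ +-monoʳ-≤ _ (length-filter≤ (∁? (between? c d)) id uys (All.map endpoint bounded)) ⟩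
    length (filter (between? c d) ys) + 2
  ∎
  where
  open ≤-Reasoning
  endpoint : ∀ {y} → c Fin.≤ y × y Fin.≤ d → ¬ (c Fin.< y × y Fin.< d) → y ∈ c ∷ d ∷ []
  endpoint (c≤y , y≤d) not-between with m≤n⇒m<n∨m≡n c≤y | m≤n⇒m<n∨m≡n y≤d
  ... | inj₂ c≡y | _        = here (toℕ-injective (sym c≡y))
  ... | inj₁ _   | inj₂ y≡d = there (here (toℕ-injective y≡d))
  ... | inj₁ c<y | inj₁ y<d = ⊥-elim (not-between (c<y , y<d))

module _ {m n : ℕ} where

  sumDiagonal differenceDiagonal : Square m n → ℕ
  sumDiagonal t = row t + col t
  -- Encodes y − x as y + (n ∸ x), which stays in ℕ and loses nothing since x ≤ n.
  differenceDiagonal t = row t + (n ∸ col t)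

  sumDiagonal-injectiveˡ : {x x′ : Fin n} {y : Fin m} →
    sumDiagonal (x , y) ≡ sumDiagonal (x′ , y) → x ≡ x′
  sumDiagonal-injectiveˡ {y = y} e = toℕ-injective (+-cancelˡ-≡ (toℕ y) _ _ e)

  sumDiagonal-injectiveʳ : {x : Fin n} {y y′ : Fin m} →
    sumDiagonal (x , y) ≡ sumDiagonal (x , y′) → y ≡ y′
  sumDiagonal-injectiveʳ {x = x} e = toℕ-injective (+-cancelʳ-≡ (toℕ x) _ _ e)

  differenceDiagonal-injectiveˡ : {x x′ : Fin n} {y : Fin m} →
    differenceDiagonal (x , y) ≡ differenceDiagonal (x′ , y) → x ≡ x′
  differenceDiagonal-injectiveˡ {x} {x′} {y} e =
    toℕ-injective (∸-cancelˡ-≡ (toℕ≤n x) (toℕ≤n x′) (+-cancelˡ-≡ (toℕ y) _ _ e))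

  differenceDiagonal-injectiveʳ : {x : Fin n} {y y′ : Fin m} →
    differenceDiagonal (x , y) ≡ differenceDiagonal (x , y′) → y ≡ y′
  differenceDiagonal-injectiveʳ {x = x} e = toℕ-injective (+-cancelʳ-≡ (n ∸ toℕ x) _ _ e)

  differenceDiagonal-cong : {s t : Square m n} → row s + col t ≡ row t + col s →
                            differenceDiagonal s ≡ differenceDiagonal t
  differenceDiagonal-cong {s} {t} e = begin
    row s + (n ∸ col s)                   ≡⟨ +-∸-assoc (row s) (toℕ≤n (proj₁ s)) ⟨
    row s + n ∸ col s                     ≡⟨ cong (λ z → row s + z ∸ col s) (m+[n∸m]≡n (toℕ≤n (proj₁ t))) ⟨
    row s + (col t + (n ∸ col t)) ∸ col s ≡⟨ cong (_∸ col s) (+-assoc (row s) (col t) (n ∸ col t)) ⟨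
    row s + col t + (n ∸ col t) ∸ col s   ≡⟨ cong (λ z → z + (n ∸ col t) ∸ col s) e ⟩
    row t + col s + (n ∸ col t) ∸ col s   ≡⟨ cong (_∸ col s) (swap (row t) (col s) (n ∸ col t)) ⟩
    row t + (n ∸ col t) + col s ∸ col s   ≡⟨ m+n∸n≡m (row t + (n ∸ col t)) (col s) ⟩
    row t + (n ∸ col t)                   ∎
    where
    open ≡-Reasoning
    swap : ∀ a b c → a + b + c ≡ a + c + b
    swap = solve-∀

  Covered : List ℕ → List ℕ → Square m n → Set
  Covered S Δ t = sumDiagonal t ∈ S ⊎ differenceDiagonal t ∈ Δ

  private
    module Columns = DecMembership (Fin._≟_ {n})
    module Rows = DecMembership (Fin._≟_ {m})

  emptyColumns : List (Square m n) → List (Fin n)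
  emptyColumns D = filter (λ x → x Columns.∉? map proj₁ D) (allFin n)

  emptyRows : List (Square m n) → List (Fin m)
  emptyRows D = filter (λ y → y Rows.∉? map proj₂ D) (allFin m)

  ∈-emptyColumns⁻ : ∀ D {x} → x ∈ emptyColumns D → x ∉ map proj₁ D
  ∈-emptyColumns⁻ D = proj₂ ∘ ∈-filter⁻ (λ x → x Columns.∉? map proj₁ D) {xs = allFin n}

  ∈-emptyRows⁻ : ∀ D {y} → y ∈ emptyRows D → y ∉ map proj₂ D
  ∈-emptyRows⁻ D = proj₂ ∘ ∈-filter⁻ (λ y → y Rows.∉? map proj₂ D) {xs = allFin m}

  unique-emptyColumns : ∀ D → Unique (emptyColumns D)
  unique-emptyColumns D = Unique.filter⁺ (λ x → x Columns.∉? map proj₁ D) (Unique.allFin⁺ n)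

  unique-emptyRows : ∀ D → Unique (emptyRows D)
  unique-emptyRows D = Unique.filter⁺ (λ y → y Rows.∉? map proj₂ D) (Unique.allFin⁺ m)

  n≤length+emptyColumns : ∀ D → n ≤ length D + length (emptyColumns D)
  n≤length+emptyColumns D = begin
      n
    ≡⟨ length-tabulate id ⟨
      length (allFin n)
    ≤⟨ length≤length+missing Fin._≟_ (map proj₁ D) (Unique.allFin⁺ n) ⟩
      length (map proj₁ D) + length (emptyColumns D)
    ≡⟨ cong (_+ length (emptyColumns D)) (length-map proj₁ D) ⟩
      length D + length (emptyColumns D)
    ∎
    where open ≤-Reasoning

  m≤length+emptyRows : ∀ D → m ≤ length D + length (emptyRows D)
  m≤length+emptyRows D = begin
      m
    ≡⟨ length-tabulate id ⟨
      length (allFin m)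
    ≤⟨ length≤length+missing Fin._≟_ (map proj₂ D) (Unique.allFin⁺ m) ⟩
      length (map proj₂ D) + length (emptyRows D)
    ≡⟨ cong (_+ length (emptyRows D)) (length-map proj₂ D) ⟩
      length D + length (emptyRows D)
    ∎
    where open ≤-Reasoning

  emptyLines-covered : ∀ D → Dominating m n D → ∀ {x y} → x ∈ emptyColumns D → y ∈ emptyRows D →
                       Covered (map sumDiagonal D) (map differenceDiagonal D) (x , y)
  emptyLines-covered D dominating {x} {y} x∈ y∈ with dominating (x , y)
  ... | inj₁ xy∈D = ⊥-elim (∈-emptyColumns⁻ D x∈ (∈-map⁺ proj₁ xy∈D))
  ... | inj₂ attacked with find attacked
  ...   | q , q∈D , inj₁ sameRow =
          ⊥-elim (∈-emptyRows⁻ D y∈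
                   (subst (_∈ map proj₂ D) (toℕ-injective sameRow) (∈-map⁺ proj₂ q∈D)))
  ...   | q , q∈D , inj₂ (inj₁ sameColumn) =
          ⊥-elim (∈-emptyColumns⁻ D x∈
                   (subst (_∈ map proj₁ D) (toℕ-injective sameColumn) (∈-map⁺ proj₁ q∈D)))
  ...   | q , q∈D , inj₂ (inj₂ (inj₁ sameDifference)) =
          inj₂ (subst (_∈ map differenceDiagonal D)
                      (differenceDiagonal-cong {s = q} {t = x , y} sameDifference)
                      (∈-map⁺ differenceDiagonal q∈D))
  ...   | q , q∈D , inj₂ (inj₂ (inj₂ sameSum)) =
          inj₁ (subst (_∈ map sumDiagonal D) sameSum (∈-map⁺ sumDiagonal q∈D))

module _ {m n : ℕ} (S Δ : List ℕ) where

  onSumDiagonal? : Decidable (λ (t : Square m n) → sumDiagonal t ∈ S)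
  onSumDiagonal? t = sumDiagonal t ∈? S
    where open DecMembership _≟_

  length-onSumDiagonal≤ : {ts : List (Square m n)} → AllPairs (_≢_ on sumDiagonal) ts →
                          length (filter onSumDiagonal? ts) ≤ length S
  length-onSumDiagonal≤ {ts} separated =
    length-filter≤ onSumDiagonal? sumDiagonal separated (All.universal (λ _ → id) ts)

  length-offSumDiagonal≤ : {ts : List (Square m n)} → AllPairs (_≢_ on differenceDiagonal) ts →
                           All (Covered S Δ) ts → length (filter (∁? onSumDiagonal?) ts) ≤ length Δ
  length-offSumDiagonal≤ separated covered =
    length-filter≤ (∁? onSumDiagonal?) differenceDiagonal separated
      (All.map (λ {t} → onDifferenceDiagonal {t}) covered)
    where
    onDifferenceDiagonal : ∀ {t} → Covered S Δ t → ¬ sumDiagonal t ∈ S → differenceDiagonal t ∈ Δ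
    onDifferenceDiagonal (inj₁ onSum) offSum = ⊥-elim (offSum onSum)
    onDifferenceDiagonal (inj₂ onDifference) _ = onDifference

  module Frame {X : List (Fin n)} {Y : List (Fin m)} (uX : Unique X) (uY : Unique Y)
               (cover : ∀ {x y} → x ∈ X → y ∈ Y → Covered S Δ (x , y))
               {a b : Fin n} (a∈X : a ∈ X) (b∈X : b ∈ X) (a≤X : All (a Fin.≤_) X) (X≤b : All (Fin._≤ b) X)
               {c d : Fin m} (c∈Y : c ∈ Y) (d∈Y : d ∈ Y)
               where

    interior : List (Fin m)
    interior = filter (between? c d) Y

    interior⁻ : ∀ {y} → y ∈ interior → y ∈ Y × c Fin.< y × y Fin.< d
    interior⁻ y∈ = ∈-filter⁻ (between? c d) y∈

    unique-interior : Unique interior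
    unique-interior = Unique.filter⁺ (between? c d) uY

    bottom top left right : List (Square m n)
    bottom = map (_, c) X
    top    = map (_, d) X
    left   = map (a ,_) interior
    right  = map (b ,_) interior

    row-covered : ∀ {y} → y ∈ Y → All (Covered S Δ) (map (_, y) X)
    row-covered y∈ = All.map⁺ (All.tabulate λ x∈ → cover x∈ y∈)

    column-covered : ∀ {x} → x ∈ X → All (Covered S Δ) (map (x ,_) interior)
    column-covered x∈ = All.map⁺ (All.tabulate λ y∈ → cover x∈ (proj₁ (interior⁻ y∈)))

    sum-bottom-right : AllPairs (_≢_ on sumDiagonal) (bottom ++ right)
    sum-bottom-right = AllPairs-map-++ (_, c) (b ,_)
      (injective⇒separated sumDiagonal-injectiveˡ uX)
      (injective⇒separated sumDiagonal-injectiveʳ unique-interior)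
      (λ x∈ y∈ → <⇒≢ (+-mono-<-≤ (proj₁ (proj₂ (interior⁻ y∈))) (All.lookup X≤b x∈)))

    sum-left-top : AllPairs (_≢_ on sumDiagonal) (left ++ top)
    sum-left-top = AllPairs-map-++ (a ,_) (_, d)
      (injective⇒separated sumDiagonal-injectiveʳ unique-interior)
      (injective⇒separated sumDiagonal-injectiveˡ uX)
      (λ y∈ x∈ → <⇒≢ (+-mono-<-≤ (proj₂ (proj₂ (interior⁻ y∈))) (All.lookup a≤X x∈)))

    difference-bottom-left : AllPairs (_≢_ on differenceDiagonal) (bottom ++ left)
    difference-bottom-left = AllPairs-map-++ (_, c) (a ,_)
      (injective⇒separated differenceDiagonal-injectiveˡ uX)
      (injective⇒separated (differenceDiagonal-injectiveʳ {x = a}) unique-interior)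
      (λ x∈ y∈ → <⇒≢ (+-mono-<-≤ (proj₁ (proj₂ (interior⁻ y∈)))
                                   (∸-monoʳ-≤ n (All.lookup a≤X x∈))))

    difference-right-top : AllPairs (_≢_ on differenceDiagonal) (right ++ top)
    difference-right-top = AllPairs-map-++ (b ,_) (_, d)
      (injective⇒separated (differenceDiagonal-injectiveʳ {x = b}) unique-interior)
      (injective⇒separated differenceDiagonal-injectiveˡ uX)
      (λ y∈ x∈ → <⇒≢ (+-mono-<-≤ (proj₂ (proj₂ (interior⁻ y∈)))
                                   (∸-monoʳ-≤ n (All.lookup X≤b x∈))))

    frame-bound : length X + length interior ≤ length S + length Δ
    frame-bound = *-cancelˡ-≤ 2 (begin
      2 * (length X + length interior)
        ≡⟨ twice (length X) (length interior) ⟩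
      length X + length interior + (length interior + length X)
        ≡⟨ cong₂ _+_ (cong₂ _+_ (length-map _ X) (length-map _ interior))
                     (cong₂ _+_ (length-map _ interior) (length-map _ X)) ⟨
      length bottom + length right + (length left + length top)
        ≤⟨ four-sides-bound onSumDiagonal? bottom right left top
             (length-onSumDiagonal≤ sum-bottom-right) (length-onSumDiagonal≤ sum-left-top)
             (length-offSumDiagonal≤ difference-bottom-left (All.++⁺ (row-covered c∈Y) (column-covered a∈X)))
             (length-offSumDiagonal≤ difference-right-top (All.++⁺ (column-covered b∈X) (row-covered d∈Y))) ⟩
      2 * (length S + length Δ) ∎)
      where
      open ≤-Reasoning
      twice : ∀ x z → 2 * (x + z) ≡ x + z + (z + x)
      twice = solve-∀

  grid-bound : {X : List (Fin n)} {Y : List (Fin m)} → Unique X → Unique Y → 0 < length X → 0 < length Y →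
               (∀ {x y} → x ∈ X → y ∈ Y → Covered S Δ (x , y)) →
               length X + length Y ≤ length S + length Δ + 2
  grid-bound {X} {Y} uX uY 0<|X| 0<|Y| cover
    with least (FinProperties.≤-totalOrder n) X 0<|X| | greatest (FinProperties.≤-totalOrder n) X 0<|X|
       | least (FinProperties.≤-totalOrder m) Y 0<|Y| | greatest (FinProperties.≤-totalOrder m) Y 0<|Y|
  ... | a , a∈X , a≤X | b , b∈X , X≤b | c , c∈Y , c≤Y | d , d∈Y , Y≤d = begin
    length X + length Y                 ≤⟨ +-monoʳ-≤ (length X) (length≤between+2 uY (All.zip (c≤Y , Y≤d))) ⟩
    length X + (length interior + 2)    ≡⟨ +-assoc (length X) (length interior) 2 ⟨
    length X + length interior + 2      ≤⟨ +-monoˡ-≤ 2 frame-bound ⟩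
    length S + length Δ + 2             ∎
    where
    open ≤-Reasoning
    open Frame uX uY cover a∈X b∈X a≤X X≤b c∈Y d∈Y

<⇒0<missing : ∀ {k n e} → k < n → n ≤ k + e → 0 < e
<⇒0<missing {k} {n} k<n n≤k+e = <-≤-trans (m<n⇒0<n∸m k<n) (m≤n+o⇒m∸n≤o n k n≤k+e)

≤4k+2⇒[s+1]/4≤k : ∀ {s} k → s ≤ 4 * k + 2 → (s + 1) / 4 ≤ k
≤4k+2⇒[s+1]/4≤k {s} k s≤4k+2 =
  s≤s⁻¹ (m<n*o⇒m/o<n (≤-trans (s≤s (+-monoˡ-≤ 1 s≤4k+2)) (≤-reflexive (four-k+3 k))))
  where
  four-k+3 : ∀ k → suc (4 * k + 2 + 1) ≡ suc k * 4
  four-k+3 = solve-∀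

m+n≤4k+2 : ∀ {m n} → m ≤ n → (D : List (Square m n)) → Dominating m n D → length D < m →
           m + n ≤ 4 * length D + 2
m+n≤4k+2 {m} {n} m≤n D dominating k<m = begin
    m + n
  ≤⟨ +-mono-≤ (m≤length+emptyRows D) (n≤length+emptyColumns D) ⟩
    k + length rows + (k + length columns)
  ≡⟨ regroup k (length rows) (length columns) ⟩
    length columns + length rows + (k + k)
  ≤⟨ +-monoˡ-≤ (k + k) columns×rows-bound ⟩
    length S + length Δ + 2 + (k + k)
  ≡⟨ cong (λ z → z + 2 + (k + k)) (cong₂ _+_ (length-map _ D) (length-map _ D)) ⟩
    k + k + 2 + (k + k)
  ≡⟨ collect k ⟩
    4 * k + 2
  ∎
  where
  open ≤-Reasoning
  k : ℕ
  k = length D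
  columns : List (Fin n)
  columns = emptyColumns D
  rows : List (Fin m)
  rows = emptyRows D
  S Δ : List ℕ
  S = map sumDiagonal D
  Δ = map differenceDiagonal D
  columns×rows-bound : length columns + length rows ≤ length S + length Δ + 2
  columns×rows-bound = grid-bound S Δ (unique-emptyColumns D) (unique-emptyRows D)
    (<⇒0<missing (<-≤-trans k<m m≤n) (n≤length+emptyColumns D))
    (<⇒0<missing k<m (m≤length+emptyRows D))
    (emptyLines-covered D dominating)
  regroup : ∀ k r c → k + r + (k + c) ≡ c + r + (k + k)
  regroup = solve-∀
  collect : ∀ k → k + k + 2 + (k + k) ≡ 4 * k + 2
  collect = solve-∀

theorem2 : (m n : ℕ) → 1 ≤ m → m ≤ n →
    (D : List (Square m n)) → Unique D → Dominating m n D →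
    m ⊓ ((m + n + 1) / 4) ≤ length D
theorem2 m n _ m≤n D _ dominating with m ≤? length D
... | yes m≤k = ≤-trans (m⊓n≤m m _) m≤k
... | no m≰k  = ≤-trans (m⊓n≤n m _)
                  (≤4k+2⇒[s+1]/4≤k (length D) (m+n≤4k+2 m≤n D dominating (≰⇒> m≰k)))
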